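{- Let $r\geq 3$ and $\varepsilon>0$, and let $G=(V,E)$ be a $K_r$-free graph with $\delta(G)\geq\left(\frac{2r-5}{2r-3}+\varepsilon\right)|V|$. If $Z\subseteq V$ satisfies $|Z|\geq\left(\frac{2r-6}{2r-3}+\varepsilon\right)|V|$, then the induced subgraph $G[Z]$ contains a copy of $K_{r-2}$.
   Context: All graphs are finite, simple, undirected and loopless. $K_s$ is the complete graph on $s$ vertices (so $K_1$ is a single vertex); $G$ is $K_r$-free if it contains no copy of $K_r$. $\delta(G)$ is the minimum degree of $G$ and $G[Z]$ is the subgraph induced on $Z$. -}

module Defs where

open import Data.Nat as ℕ using (ℕ; suc; _∸_; _<_)
open import Data.Fin using (Fin)
open import Data.Fin.Subset using (Subset; _∈_; ∣_∣; ⊤)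
open import Data.Vec using (tabulate)
open import Data.Bool using (Bool; true; false)
open import Data.Integer as ℤ using (ℤ; +_)
open import Data.Rational using (ℚ; _/_)
open import Data.Product using (Σ; _×_)
open import Relation.Binary.PropositionalEquality using (_≡_; _≢_)
open import Relation.Nullary using (¬_)
open import Function.Definitions using (Injective)

record Graph (n : ℕ) : Set where
  field
    Adj    : Fin n → Fin n → Bool
    sym    : ∀ u v → Adj u v ≡ Adj v u
    irrefl : ∀ v → Adj v v ≡ false

open Graph public

-- neighbourhood of u as a subset (Side = Bool, inside = true)
N : ∀ {n} → Graph n → Fin n → Subset n
N G u = tabulate (Adj G u)

degree : ∀ {n} → Graph n → Fin n → ℕ
degree G u = ∣ N G u ∣

HasCliqueIn : ∀ {n} → Graph n → ℕ → Subset n → Set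
HasCliqueIn {n} G s Z =
  Σ (Fin s → Fin n) λ f →
    Injective _≡_ _≡_ f
    × (∀ i → f i ∈ Z)
    × (∀ i j → i ≢ j → Adj G (f i) (f j) ≡ true)

KFree : ∀ {n} → Graph n → ℕ → Set
KFree G r = ¬ HasCliqueIn G r ⊤

ℕ→ℚ : ℕ → ℚ
ℕ→ℚ m = (+ m) / 1

-- (2r - a) / (2r - 3) as a rational; the denominator is written
-- suc (2r ∸ 4), which equals 2r - 3 for every r ≥ 2.
ratio : ℕ → ℕ → ℚ
ratio r a = ((+ (2 ℕ.* r)) ℤ.- (+ a)) / suc (2 ℕ.* r ∸ 4)

-- Put d = 2r − 3.  The degree bound says that every vertex has
-- fewer than 2n/d non-neighbours, so intersecting a vertex set with the
-- neighbourhood of one of its vertices loses fewer than 2n/d vertices.  Since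
-- |Z| > (r − 3)·2n/d, one can pick a vertex of Z, pass to its neighbours
-- inside Z, and repeat r − 2 times; the vertices picked form a K_{r−2} in
-- G[Z].
module Submission where

open import Defs hiding (sym)
open import Data.Nat as ℕ using (ℕ; zero; suc; _+_; _*_; _∸_; _≤_; _<_; z≤n; s≤s)
import Data.Nat.Properties as ℕ
open import Data.Integer as ℤ using (ℤ)
import Data.Integer.Properties as ℤ
open import Data.Rational as ℚ using (ℚ; 0ℚ; _/_; toℚᵘ) renaming (_≤_ to _≤ℚ_; _<_ to _<ℚ_)
import Data.Rational.Properties as ℚ
import Data.Rational.Unnormalised as ℚᵘ
import Data.Rational.Unnormalised.Properties as ℚᵘ
open import Data.Fin using (Fin; zero; suc)
open import Data.Fin.Subset using (Subset; Nonempty; _∈_; _∩_; _∪_; ∣_∣; inside; outside)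
open import Data.Fin.Subset.Properties using (p∩q⊆p; p∩q⊆q; ∣p∣≤n)
open import Data.Vec using ([]; _∷_; here; there)
open import Data.Vec.Properties using (lookup∘tabulate; []=⇒lookup)
open import Data.Bool using (true)
open import Data.Product using (_,_)
open import Data.Empty using (⊥-elim)
open import Function using (_∘′_)
open import Relation.Binary.PropositionalEquality
open import Data.Nat.Tactic.RingSolver using (solve-∀)

∣p∣>0⇒Nonempty : ∀ {n} (p : Subset n) → 0 < ∣ p ∣ → Nonempty p
∣p∣>0⇒Nonempty (inside  ∷ p) _ = zero , here
∣p∣>0⇒Nonempty (outside ∷ p) h with ∣p∣>0⇒Nonempty p h
... | x , x∈p = suc x , there x∈p

suc-cong-+ : ∀ {a b c e} → a + b ≡ c + e → a + suc b ≡ c + suc e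
suc-cong-+ {a} {b} {c} {e} eq = trans (ℕ.+-suc a b) (trans (cong suc eq) (sym (ℕ.+-suc c e)))

∣p∩q∣+∣p∪q∣≡∣p∣+∣q∣ : ∀ {n} (p q : Subset n) → ∣ p ∩ q ∣ + ∣ p ∪ q ∣ ≡ ∣ p ∣ + ∣ q ∣
∣p∩q∣+∣p∪q∣≡∣p∣+∣q∣ []            []            = refl
∣p∩q∣+∣p∪q∣≡∣p∣+∣q∣ (inside  ∷ p) (inside  ∷ q) = cong suc (suc-cong-+ (∣p∩q∣+∣p∪q∣≡∣p∣+∣q∣ p q))
∣p∩q∣+∣p∪q∣≡∣p∣+∣q∣ (inside  ∷ p) (outside ∷ q) =
  trans (ℕ.+-suc ∣ p ∩ q ∣ ∣ p ∪ q ∣) (cong suc (∣p∩q∣+∣p∪q∣≡∣p∣+∣q∣ p q))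
∣p∩q∣+∣p∪q∣≡∣p∣+∣q∣ (outside ∷ p) (inside  ∷ q) = suc-cong-+ (∣p∩q∣+∣p∪q∣≡∣p∣+∣q∣ p q)
∣p∩q∣+∣p∪q∣≡∣p∣+∣q∣ (outside ∷ p) (outside ∷ q) = ∣p∩q∣+∣p∪q∣≡∣p∣+∣q∣ p q

∣p∣+∣q∣≤∣p∩q∣+n : ∀ {n} (p q : Subset n) → ∣ p ∣ + ∣ q ∣ ≤ ∣ p ∩ q ∣ + n
∣p∣+∣q∣≤∣p∩q∣+n p q = begin
  ∣ p ∣ + ∣ q ∣         ≡⟨ ∣p∩q∣+∣p∪q∣≡∣p∣+∣q∣ p q ⟨
  ∣ p ∩ q ∣ + ∣ p ∪ q ∣ ≤⟨ ℕ.+-monoʳ-≤ ∣ p ∩ q ∣ (∣p∣≤n (p ∪ q)) ⟩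
  ∣ p ∩ q ∣ + _         ∎
  where open ℕ.≤-Reasoning

∈N⇒Adj : ∀ {n} (G : Graph n) {u v} → v ∈ N G u → Adj G u v ≡ true
∈N⇒Adj G {u} {v} v∈Nu = trans (sym (lookup∘tabulate (Adj G u) v)) ([]=⇒lookup v∈Nu)

emptyClique : ∀ {n} (G : Graph n) (S : Subset n) → HasCliqueIn G 0 S
emptyClique G S = (λ ()) , (λ { {()} }) , (λ ()) , (λ ())

extendClique : ∀ {n} (G : Graph n) {s} (S : Subset n) {v} → v ∈ S →
  HasCliqueIn G s (S ∩ N G v) → HasCliqueIn G (suc s) S
extendClique {n} G {s} S {v} v∈S (g , g-inj , g∈ , g-adj) = f , f-inj , f∈S , f-adj
  where
  v~g : ∀ i → Adj G v (g i) ≡ true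
  v~g i = ∈N⇒Adj G (p∩q⊆q S (N G v) (g∈ i))

  g≢v : ∀ i → g i ≢ v
  g≢v i refl with trans (sym (v~g i)) (irrefl G v)
  ... | ()

  f : Fin (suc s) → Fin n
  f zero    = v
  f (suc i) = g i

  f-inj : ∀ {i j} → f i ≡ f j → i ≡ j
  f-inj {zero}  {zero}  _ = refl
  f-inj {zero}  {suc j} e = ⊥-elim (g≢v j (sym e))
  f-inj {suc i} {zero}  e = ⊥-elim (g≢v i e)
  f-inj {suc i} {suc j} e = cong suc (g-inj e)

  f∈S : ∀ i → f i ∈ S
  f∈S zero    = v∈S
  f∈S (suc i) = p∩q⊆p S (N G v) (g∈ i)

  f-adj : ∀ i j → i ≢ j → Adj G (f i) (f j) ≡ true
  f-adj zero    zero    i≢j = ⊥-elim (i≢j refl)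
  f-adj zero    (suc j) _   = v~g j
  f-adj (suc i) zero    _   = trans (Graph.sym G (g i) v) (v~g i)
  f-adj (suc i) (suc j) i≢j = g-adj i j (i≢j ∘′ cong suc)

module _ {n} (G : Graph n) (m d : ℕ) (fewNonNeighbours : ∀ v → n * d < degree G v * d + m) where

  common-neighbours : ∀ j (S : Subset n) {v} → m + j * m < ∣ S ∣ * d →
    j * m < ∣ S ∩ N G v ∣ * d
  common-neighbours j S {v} size = ℕ.+-cancelʳ-< (m + B) (j * m) (C * d) (begin-strict
    j * m + (m + B)      ≡⟨ ℕ.+-assoc (j * m) m B ⟨
    (j * m + m) + B      ≡⟨ cong (_+ B) (ℕ.+-comm (j * m) m) ⟩
    (m + j * m) + B      <⟨ ℕ.+-monoˡ-< B size ⟩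
    ∣ S ∣ * d + B        ≡⟨ ℕ.*-distribʳ-+ d ∣ S ∣ (degree G v) ⟨
    (∣ S ∣ + degree G v) * d ≤⟨ ℕ.*-monoˡ-≤ d (∣p∣+∣q∣≤∣p∩q∣+n S (N G v)) ⟩
    (C + n) * d          ≡⟨ ℕ.*-distribʳ-+ d C n ⟩
    C * d + n * d        <⟨ ℕ.+-monoʳ-< (C * d) (fewNonNeighbours v) ⟩
    C * d + (B + m)      ≡⟨ cong (C * d +_) (ℕ.+-comm B m) ⟩
    C * d + (m + B)      ∎)
    where
    open ℕ.≤-Reasoning
    B = degree G v * d
    C = ∣ S ∩ N G v ∣

  greedyClique : ∀ j (S : Subset n) → j * m < ∣ S ∣ * d → HasCliqueIn G (suc j) S
  greedyClique j S size with ∣p∣>0⇒Nonempty S ∣S∣>0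
    where
    ∣S∣>0 : 0 < ∣ S ∣
    ∣S∣>0 = ℕ.>-nonZero⁻¹ ∣ S ∣ {{ℕ.m*n≢0⇒m≢0 ∣ S ∣ {{ℕ.>-nonZero (ℕ.≤-<-trans z≤n size)}}}}
  greedyClique zero    S size | v , v∈S = extendClique G S v∈S (emptyClique G (S ∩ N G v))
  greedyClique (suc j) S size | v , v∈S =
    extendClique G S v∈S (greedyClique j (S ∩ N G v) (common-neighbours j S size))

[a/k]*p<z⇒a*p<z*k : ∀ (a : ℤ) k p z → (a / suc k) ℚ.* ℕ→ℚ p <ℚ ℕ→ℚ z →
  a ℤ.* ℤ.+ p ℤ.< ℤ.+ z ℤ.* ℤ.+ suc k
[a/k]*p<z⇒a*p<z*k a k p z h =
  subst₂ ℤ._<_ (ℤ.*-identityʳ _) (cong (λ t → ℤ.+ z ℤ.* ℤ.+ t) (ℕ.*-identityʳ (suc k)))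
    (ℚᵘ.drop-*<* (ℚᵘ.<-respʳ-≃ z≃ (ℚᵘ.<-respˡ-≃ [a/k]*p≃ (ℚ.toℚᵘ-mono-< h))))
  where
  [a/k]*p≃ : toℚᵘ ((a / suc k) ℚ.* ℕ→ℚ p) ℚᵘ.≃ ℚᵘ.mkℚᵘ a k ℚᵘ.* ℚᵘ.mkℚᵘ (ℤ.+ p) 0
  [a/k]*p≃ = ℚᵘ.≃-trans (ℚ.toℚᵘ-homo-* (a / suc k) (ℕ→ℚ p))
    (ℚᵘ.*-cong (ℚ.toℚᵘ-fromℚᵘ (ℚᵘ.mkℚᵘ a k)) (ℚ.toℚᵘ-fromℚᵘ (ℚᵘ.mkℚᵘ (ℤ.+ p) 0)))
  z≃ : toℚᵘ (ℕ→ℚ z) ℚᵘ.≃ ℚᵘ.mkℚᵘ (ℤ.+ z) 0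
  z≃ = ℚ.toℚᵘ-fromℚᵘ (ℚᵘ.mkℚᵘ (ℤ.+ z) 0)

ratio-bound : ∀ r a z {ε n} → a ≤ 2 * r → 0ℚ <ℚ ε → 0 < n →
  (ratio r a ℚ.+ ε) ℚ.* ℕ→ℚ n ≤ℚ ℕ→ℚ z → (2 * r ∸ a) * n < z * suc (2 * r ∸ 4)
ratio-bound r a z {ε} {suc m} a≤2r ε>0 _ h = ℤ.drop‿+<+ (subst₂ ℤ._<_ lhs≡ rhs≡ ℤ-bound)
  where
  x = ratio r a
  instance
    n-positive : ℚ.Positive (ℕ→ℚ (suc m))
    n-positive = ℚ.normalize-pos (suc m) 1
  x<x+ε : x <ℚ x ℚ.+ ε
  x<x+ε = subst (_<ℚ x ℚ.+ ε) (ℚ.+-identityʳ x) (ℚ.+-monoʳ-< x ε>0)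
  x*n<z : x ℚ.* ℕ→ℚ (suc m) <ℚ ℕ→ℚ z
  x*n<z = ℚ.<-≤-trans (ℚ.*-monoˡ-<-pos (ℕ→ℚ (suc m)) x<x+ε) h
  ℤ-bound = [a/k]*p<z⇒a*p<z*k (ℤ.+ (2 * r) ℤ.- ℤ.+ a) (2 * r ∸ 4) (suc m) z x*n<z
  lhs≡ : (ℤ.+ (2 * r) ℤ.- ℤ.+ a) ℤ.* ℤ.+ suc m ≡ ℤ.+ ((2 * r ∸ a) * suc m)
  lhs≡ = trans (cong (ℤ._* ℤ.+ suc m) (trans (ℤ.m-n≡m⊖n (2 * r) a) (ℤ.⊖-≥ a≤2r)))
               (sym (ℤ.pos-* (2 * r ∸ a) (suc m)))
  rhs≡ : ℤ.+ z ℤ.* ℤ.+ suc (2 * r ∸ 4) ≡ ℤ.+ (z * suc (2 * r ∸ 4))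
  rhs≡ = sym (ℤ.pos-* z (suc (2 * r ∸ 4)))

ratio[3+t]-bound : ∀ t c x {ε n} → c ≤ 6 → 0ℚ <ℚ ε → 0 < n →
  (ratio (3 + t) c ℚ.+ ε) ℚ.* ℕ→ℚ n ≤ℚ ℕ→ℚ x → (6 + 2 * t ∸ c) * n < x * (3 + 2 * t)
ratio[3+t]-bound t c x {n = n} c≤6 ε>0 n>0 h =
  subst (λ M → (M ∸ c) * n < x * suc (M ∸ 4)) 2r≡6+2t (ratio-bound (3 + t) c x c≤2r ε>0 n>0 h)
  where
  2r≡6+2t : 2 * (3 + t) ≡ 6 + 2 * t
  2r≡6+2t = ℕ.*-distribˡ-+ 2 3 t
  c≤2r : c ≤ 2 * (3 + t)
  c≤2r = subst (c ≤_) (sym 2r≡6+2t) (ℕ.≤-trans c≤6 (ℕ.m≤m+n 6 (2 * t)))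

[1+2k]*m+2m≡m*[3+2k] : ∀ k m → (1 + 2 * k) * m + 2 * m ≡ m * (3 + 2 * k)
[1+2k]*m+2m≡m*[3+2k] = solve-∀

2k*m≡k*2m : ∀ k m → 2 * k * m ≡ k * (2 * m)
2k*m≡k*2m = solve-∀

proposition2p3 : (r : ℕ) → 3 ≤ r → (ε : ℚ) → 0ℚ <ℚ ε →
    (n : ℕ) → 0 < n → (G : Graph n) → KFree G r →
    (∀ v → (ratio r 5 ℚ.+ ε) ℚ.* ℕ→ℚ n ≤ℚ ℕ→ℚ (degree G v)) →
    (Z : Subset n) → (ratio r 6 ℚ.+ ε) ℚ.* ℕ→ℚ n ≤ℚ ℕ→ℚ ∣ Z ∣ →
    HasCliqueIn G (r ∸ 2) Z
proposition2p3 _ (s≤s (s≤s (s≤s {n = t} _))) ε ε>0 n n>0 G _ δ-bound Z Z-bound =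
  greedyClique G (2 * n) (3 + 2 * t) fewNonNeighbours t Z large
  where
  fewNonNeighbours : ∀ v → n * (3 + 2 * t) < degree G v * (3 + 2 * t) + 2 * n
  fewNonNeighbours v = subst (_< degree G v * (3 + 2 * t) + 2 * n) ([1+2k]*m+2m≡m*[3+2k] t n)
    (ℕ.+-monoˡ-< (2 * n) (ratio[3+t]-bound t 5 (degree G v) (ℕ.n≤1+n 5) ε>0 n>0 (δ-bound v)))

  large : t * (2 * n) < ∣ Z ∣ * (3 + 2 * t)
  large = subst (_< ∣ Z ∣ * (3 + 2 * t)) (2k*m≡k*2m t n)
    (ratio[3+t]-bound t 6 ∣ Z ∣ ℕ.≤-refl ε>0 n>0 Z-bound)
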